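{- Let $q\in\mathbb{N}$ with $q\geq 1$ and let $G$ be a graph. If $G$ is $p$-ordered for some integer $p\geq 3$, then $C_q(G)$ is $q(p-1)$-connected.
   Context: For $p\geq 3$, a graph is $p$-ordered if for every $p$-tuple $(v_1,\dots,v_p)$ of (distinct) vertices there is a cycle in the graph that contains $v_1,\dots,v_p$ and visits them in this order. For a graph $G=(V,E)$ and positive integer $q$, the $q$-complete graph $C_q(G)=(V_q,E_q)$ has vertex set $V_q=V^1\uplus\dots\uplus V^q$ where $V^i=\{v^i\mid v\in V\}$ is a copy of $V$ for each $i\in\{1,\dots,q\}$, and edge set $E_q=\bigcup_{i,j\in\{1,\dots,q\}}\{\{u^i,v^j\}\mid \{u,v\}\in E\}$. A graph is $k$-connected in the usual (vertex-connectivity) sense. -}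

module Defs where

open import Data.Nat using (ℕ; zero; suc; _*_; _≤_; _<_)
open import Data.Fin using (Fin; fromℕ; inject₁; remainder) renaming (zero to fzero; suc to fsuc; _<_ to _<ᶠ_)
open import Data.Fin.Subset using (Subset; _∉_; ∣_∣)
open import Data.Product using (Σ; ∃; _×_; _,_)
open import Relation.Nullary using (¬_)
open import Relation.Binary.PropositionalEquality using (_≡_)
open import Function.Definitions using (Injective)

record Graph : Set₁ where
  field
    n      : ℕ
    Adj    : Fin n → Fin n → Set
    sym    : ∀ {u v} → Adj u v → Adj v u
    irrefl : ∀ {v} → ¬ Adj v v

open Graph public

record Cycle (G : Graph) : Set where
  field
    m        : ℕ
    len≥3    : 2 ≤ m
    c        : Fin (suc m) → Fin (n G)
    distinct : Injective _≡_ _≡_ c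
    step     : ∀ (i : Fin m) → Adj G (c (inject₁ i)) (c (fsuc i))
    close    : Adj G (c (fromℕ m)) (c fzero)

open Cycle public

-- The cycle C contains v 0, …, v (p-1) and visits them in this order:
-- (after choosing the starting point/direction of the listing of C, which is
-- free since C is existentially quantified) they occur at strictly increasing positions.
VisitsInOrder : {G : Graph} {p : ℕ} → Cycle G → (Fin p → Fin (n G)) → Set
VisitsInOrder {p = p} C v =
  Σ (Fin p → Fin (suc (m C))) λ f →
    (∀ i j → i <ᶠ j → f i <ᶠ f j) × (∀ i → c C (f i) ≡ v i)

POrdered : ℕ → Graph → Set
POrdered p G = (v : Fin p → Fin (n G)) → Injective _≡_ _≡_ v →
  Σ (Cycle G) λ C → VisitsInOrder C v

data ReachAvoiding (G : Graph) (S : Subset (n G)) : Fin (n G) → Fin (n G) → Set where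
  here  : ∀ {x} → ReachAvoiding G S x x
  there : ∀ {x y z} → Adj G x y → y ∉ S → ReachAvoiding G S y z → ReachAvoiding G S x z

ConnectedWithout : (G : Graph) → Subset (n G) → Set
ConnectedWithout G S = ∀ x y → x ∉ S → y ∉ S → ReachAvoiding G S x y

KConnected : ℕ → Graph → Set
KConnected k G = (k < n G) × (∀ (S : Subset (n G)) → ∣ S ∣ < k → ConnectedWithout G S)

-- The q-complete graph C_q(G): vertex set Fin (q * n) ≅ Fin q × Fin n
-- (via remQuot: vertex x is the copy (quotient x) of vertex (remainder x));
-- u^i ~ v^j iff u ~ v in G.
Complete : ℕ → Graph → Graph
Complete q G = record
  { n      = q * n G
  ; Adj    = λ x y → Adj G (remainder {q} (n G) x) (remainder {q} (n G) y)
  ; sym    = sym G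
  ; irrefl = irrefl G
  }

-- Let S be a set of fewer than q(p-1) vertices of C_q(G), and let T be the set
-- of vertices of G all of whose q copies lie in S; then q∣T∣ ≤ ∣S∣, so ∣T∣ ≤ p-2.
-- Since G is p-ordered, any two distinct vertices u, w outside T lie on a cycle
-- visiting u, w and then p-2 further vertices covering T in this order, and the
-- arc of that cycle from u to w avoids T. Every vertex of this walk outside T
-- has a copy outside S, and adjacency in C_q(G) ignores the copy index, so the
-- walk lifts to C_q(G) - S between any copies of u and w.
module Submission where

open import Defs hiding (sym)
open import Defs using () renaming (sym to adj-sym)
open import Data.Nat using (ℕ; zero; suc; _+_; _*_; _∸_; _≤_; _<_; z≤n; s≤s; _≤?_)
open import Data.Nat.Properties hiding (_≟_)
open import Data.Fin using (Fin; toℕ; inject₁; _↑ˡ_; _↑ʳ_; combine; remainder; quotient; _≟_)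
  renaming (zero to fzero; suc to fsuc)
import Data.Fin.Properties as Finₚ
open import Data.Fin.Subset using (Subset; _∈_; _∉_; ∣_∣; _∩_; _∪_; ⁅_⁆; ⊤; inside; outside; Empty)
open import Data.Fin.Subset.Properties
  using (∣p∣≤n; drop-there; drop-∷-Empty; x∈p∩q⁺; x∈p∩q⁻; ∣p∩q∣≤∣p∣; ∣p∩q∣≤∣q∣; ∈⊤;
         _∈?_; x∈p∪q⁺; x∈p∪q⁻; x∈⁅x⁆; x∈⁅y⁆⇒x≡y; ∣⁅x⁆∣≡1)
open import Data.Vec.Base using ([]; _∷_; here; there; take; drop)
open import Data.Vec.Functional using () renaming (_∷_ to _∷ᶠ_)
open import Data.Product using (Σ; ∃; _×_; _,_; proj₁; proj₂)
open import Data.Sum using (inj₁; inj₂)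
open import Data.Empty using (⊥-elim)
open import Relation.Nullary using (yes; no; contradiction)
open import Relation.Binary.PropositionalEquality
open import Function using (_∘_; id)
open import Function.Bundles using (_⇔_; mk⇔; Equivalence)
open import Function.Definitions using (Injective)

open Equivalence using (to; from)

∣p∪q∣≤∣p∣+∣q∣ : ∀ {n} (p q : Subset n) → ∣ p ∪ q ∣ ≤ ∣ p ∣ + ∣ q ∣
∣p∪q∣≤∣p∣+∣q∣ []            []            = z≤n
∣p∪q∣≤∣p∣+∣q∣ (inside  ∷ p) (inside  ∷ q) =
  s≤s (≤-trans (m≤n⇒m≤1+n (∣p∪q∣≤∣p∣+∣q∣ p q)) (≤-reflexive (sym (+-suc _ _))))
∣p∪q∣≤∣p∣+∣q∣ (inside  ∷ p) (outside ∷ q) = s≤s (∣p∪q∣≤∣p∣+∣q∣ p q)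
∣p∪q∣≤∣p∣+∣q∣ (outside ∷ p) (inside  ∷ q) =
  ≤-trans (s≤s (∣p∪q∣≤∣p∣+∣q∣ p q)) (≤-reflexive (sym (+-suc _ _)))
∣p∪q∣≤∣p∣+∣q∣ (outside ∷ p) (outside ∷ q) = ∣p∪q∣≤∣p∣+∣q∣ p q

Empty[p∩q]⇒∣p∣+∣q∣≤n : ∀ {n} (p q : Subset n) → Empty (p ∩ q) → ∣ p ∣ + ∣ q ∣ ≤ n
Empty[p∩q]⇒∣p∣+∣q∣≤n []            []            _ = z≤n
Empty[p∩q]⇒∣p∣+∣q∣≤n (inside  ∷ p) (inside  ∷ q) e = contradiction (fzero , here) e
Empty[p∩q]⇒∣p∣+∣q∣≤n (inside  ∷ p) (outside ∷ q) e =
  s≤s (Empty[p∩q]⇒∣p∣+∣q∣≤n p q (drop-∷-Empty e))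
Empty[p∩q]⇒∣p∣+∣q∣≤n (outside ∷ p) (inside  ∷ q) e =
  ≤-trans (≤-reflexive (+-suc _ _)) (s≤s (Empty[p∩q]⇒∣p∣+∣q∣≤n p q (drop-∷-Empty e)))
Empty[p∩q]⇒∣p∣+∣q∣≤n (outside ∷ p) (outside ∷ q) e =
  m≤n⇒m≤1+n (Empty[p∩q]⇒∣p∣+∣q∣≤n p q (drop-∷-Empty e))

∣p∣<n⇒∃∉ : ∀ {n} (p : Subset n) → ∣ p ∣ < n → ∃ λ x → x ∉ p
∣p∣<n⇒∃∉ (inside  ∷ p) (s≤s ∣p∣<n) with ∣p∣<n⇒∃∉ p ∣p∣<n
... | x , x∉p = fsuc x , x∉p ∘ drop-there
∣p∣<n⇒∃∉ (outside ∷ p) _ = fzero , λ ()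

∷-injective : ∀ {n k} {x : Fin n} {g : Fin k → Fin n} →
              Injective _≡_ _≡_ g → (∀ i → g i ≢ x) → Injective _≡_ _≡_ (x ∷ᶠ g)
∷-injective inj x∉g {fzero}  {fzero}  _ = refl
∷-injective inj x∉g {fzero}  {fsuc j} e = ⊥-elim (x∉g j (sym e))
∷-injective inj x∉g {fsuc i} {fzero}  e = ⊥-elim (x∉g i e)
∷-injective inj x∉g {fsuc i} {fsuc j} e = cong fsuc (inj e)

record Listing {n : ℕ} (m : ℕ) (X Y : Subset n) : Set where
  field
    enum      : Fin m → Fin n
    injective : Injective _≡_ _≡_ enum
    avoids    : ∀ i → enum i ∉ Y
    covers    : ∀ {x} → x ∈ X → ∃ λ i → enum i ≡ x

open Listing

listing-∷-used : ∀ {n m} b {X Y : Subset n} → Listing m X Y → Listing (suc m) (b ∷ X) (outside ∷ Y)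
listing-∷-used b L = record
  { enum      = fzero ∷ᶠ (fsuc ∘ enum L)
  ; injective = ∷-injective (injective L ∘ Finₚ.suc-injective) (λ _ ())
  ; avoids    = λ { fzero (); (fsuc i) (there h) → avoids L i h }
  ; covers    = λ { {fzero} _ → fzero , refl
                  ; {fsuc x} (there h) → let i , e = covers L h in fsuc i , cong fsuc e }
  }

listing-∷-skipped : ∀ {n m} b {X Y : Subset n} → Listing m X Y → Listing m (outside ∷ X) (b ∷ Y)
listing-∷-skipped b L = record
  { enum      = fsuc ∘ enum L
  ; injective = injective L ∘ Finₚ.suc-injective
  ; avoids    = λ i → avoids L i ∘ drop-there
  ; covers    = λ { {fsuc x} (there h) → let i , e = covers L h in i , cong fsuc e }
  }

listing : ∀ {n} m (X Y : Subset n) → Empty (X ∩ Y) → ∣ X ∣ ≤ m → m + ∣ Y ∣ ≤ n → Listing m X Y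
listing zero [] [] _ _ _ = record
  { enum = λ (); injective = λ {x} → λ {}; avoids = λ (); covers = λ () }
listing m (inside ∷ X) (inside ∷ Y) e _ _ = contradiction (fzero , here) e
listing (suc m) (inside ∷ X) (outside ∷ Y) e (s≤s ∣X∣≤m) (s≤s m+∣Y∣≤n) =
  listing-∷-used inside (listing m X Y (drop-∷-Empty e) ∣X∣≤m m+∣Y∣≤n)
listing m (outside ∷ X) (inside ∷ Y) e ∣X∣≤m m+∣Y∣<n =
  listing-∷-skipped inside (listing m X Y (drop-∷-Empty e) ∣X∣≤m
    (≤-pred (≤-trans (≤-reflexive (sym (+-suc m ∣ Y ∣))) m+∣Y∣<n)))
listing {suc n} m (outside ∷ X) (outside ∷ Y) e ∣X∣≤m m+∣Y∣≤1+n with m + ∣ Y ∣ ≤? n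
... | yes m+∣Y∣≤n = listing-∷-skipped outside (listing m X Y (drop-∷-Empty e) ∣X∣≤m m+∣Y∣≤n)
listing {suc n} zero    (outside ∷ X) (outside ∷ Y) e _ _ | no ∣Y∣≰n = contradiction (∣p∣≤n Y) ∣Y∣≰n
listing {suc n} (suc m) (outside ∷ X) (outside ∷ Y) e _ (s≤s m+∣Y∣≤n) | no 1+m+∣Y∣≰n =
  listing-∷-used outside (listing m X Y (drop-∷-Empty e) ∣X∣≤m m+∣Y∣≤n)
  where
  -- the bound is tight here, m + 1 + ∣ Y ∣ = n + 1, so disjointness forces ∣ X ∣ ≤ m
  ∣X∣≤m : ∣ X ∣ ≤ m
  ∣X∣≤m = ≤-pred (+-cancelʳ-≤ ∣ Y ∣ (suc ∣ X ∣) (suc m)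
            (≤-trans (s≤s (Empty[p∩q]⇒∣p∣+∣q∣≤n X Y (drop-∷-Empty e))) (≰⇒> 1+m+∣Y∣≰n)))

-- Copy i of v is combine i v, at position i * n + v, so take n and drop n split off copy 0.
∈-take : ∀ n {m} (S : Subset (n + m)) {v : Fin n} → (v ↑ˡ m) ∈ S ⇔ v ∈ take n S
∈-take (suc n) (s ∷ S) {fzero}  = mk⇔ (λ { here → here }) (λ { here → here })
∈-take (suc n) (s ∷ S) {fsuc v} =
  mk⇔ (there ∘ to (∈-take n S) ∘ drop-there) (there ∘ from (∈-take n S) ∘ drop-there)

∈-drop : ∀ n {m} (S : Subset (n + m)) {v : Fin m} → (n ↑ʳ v) ∈ S ⇔ v ∈ drop n S
∈-drop zero    S       = mk⇔ id id
∈-drop (suc n) (s ∷ S) = mk⇔ (to (∈-drop n S) ∘ drop-there) (there ∘ from (∈-drop n S))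

∣take∣+∣drop∣≡∣S∣ : ∀ n {m} (S : Subset (n + m)) → ∣ take n S ∣ + ∣ drop n S ∣ ≡ ∣ S ∣
∣take∣+∣drop∣≡∣S∣ zero    S             = refl
∣take∣+∣drop∣≡∣S∣ (suc n) (inside  ∷ S) = cong suc (∣take∣+∣drop∣≡∣S∣ n S)
∣take∣+∣drop∣≡∣S∣ (suc n) (outside ∷ S) = ∣take∣+∣drop∣≡∣S∣ n S

allCopies : ∀ q {n} → Subset (q * n) → Subset n
allCopies zero    S = ⊤
allCopies (suc q) {n} S = take n S ∩ allCopies q (drop n S)

allCopies-card : ∀ q {n} (S : Subset (q * n)) → q * ∣ allCopies q S ∣ ≤ ∣ S ∣
allCopies-card zero    S = z≤n
allCopies-card (suc q) {n} S = begin
  ∣ A ∩ T ∣ + q * ∣ A ∩ T ∣ ≤⟨ +-mono-≤ (∣p∩q∣≤∣p∣ A T) (*-monoʳ-≤ q (∣p∩q∣≤∣q∣ A T)) ⟩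
  ∣ A ∣ + q * ∣ T ∣         ≤⟨ +-monoʳ-≤ ∣ A ∣ (allCopies-card q (drop n S)) ⟩
  ∣ A ∣ + ∣ drop n S ∣      ≡⟨ ∣take∣+∣drop∣≡∣S∣ n S ⟩
  ∣ S ∣                     ∎
  where
  open ≤-Reasoning
  A = take n S
  T = allCopies q (drop n S)

∈allCopies⇒∈ : ∀ q {n} (S : Subset (q * n)) {v : Fin n} → v ∈ allCopies q S → ∀ (i : Fin q) → combine i v ∈ S
∈allCopies⇒∈ (suc q) {n} S v∈ fzero    = from (∈-take n S) (proj₁ (x∈p∩q⁻ (take n S) _ v∈))
∈allCopies⇒∈ (suc q) {n} S v∈ (fsuc i) =
  from (∈-drop n S) (∈allCopies⇒∈ q (drop n S) (proj₂ (x∈p∩q⁻ (take n S) _ v∈)) i)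

∉allCopies⇒∉ : ∀ q {n} (S : Subset (q * n)) {v : Fin n} → v ∉ allCopies q S →
               ∃ λ (i : Fin q) → combine i v ∉ S
∉allCopies⇒∉ zero    S v∉ = ⊥-elim (v∉ ∈⊤)
∉allCopies⇒∉ (suc q) {n} S {v} v∉ with v ∈? take n S
... | no  v∉A = fzero , v∉A ∘ to (∈-take n S)
... | yes v∈A with ∉allCopies⇒∉ q (drop n S) (v∉ ∘ x∈p∩q⁺ ∘ (v∈A ,_))
...   | i , copy∉ = fsuc i , copy∉ ∘ to (∈-drop n S)

∉⇒remainder∉allCopies : ∀ q {n} (S : Subset (q * n)) {x} → x ∉ S → remainder {q} n x ∉ allCopies q S
∉⇒remainder∉allCopies q {n} S {x} x∉S r∈ =
  x∉S (subst (_∈ S) (Finₚ.combine-remQuot {q} n x) (∈allCopies⇒∈ q S r∈ (quotient {q} n x)))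

remainder-combine : ∀ {q n} (i : Fin q) (v : Fin n) → remainder {q} n (combine i v) ≡ v
remainder-combine i v = cong proj₂ (Finₚ.remQuot-combine i v)

module _ {G : Graph} {S : Subset (n G)} where

  reach-∷ʳ : ∀ {x y z} → ReachAvoiding G S x y → Adj G y z → z ∉ S → ReachAvoiding G S x z
  reach-∷ʳ here             y~z z∉S = there y~z z∉S here
  reach-∷ʳ (there x~ y∉ r) y~z z∉S = there x~ y∉ (reach-∷ʳ r y~z z∉S)

  reach-lastEdge : ∀ {x y} → ReachAvoiding G S x y → x ≢ y →
                   ∃ λ y′ → ReachAvoiding G S x y′ × Adj G y′ y
  reach-lastEdge here x≢y = contradiction refl x≢y
  reach-lastEdge {x} {y} (there {y = z} x~z z∉S r) _ with z ≟ y
  ... | yes refl = x , here , x~z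
  ... | no  z≢y  = let y′ , r′ , y′~y = reach-lastEdge r z≢y in y′ , there x~z z∉S r′ , y′~y

  reach-firstEdge : ∀ {x y} → ReachAvoiding G S x y → x ≢ y → ∃ λ z → Adj G x z × z ∉ S
  reach-firstEdge here               x≢y = contradiction refl x≢y
  reach-firstEdge (there x~z z∉S _) _   = _ , x~z , z∉S

  cycle-arc : (C : Cycle G) (a b : Fin (suc (m C))) → toℕ a ≤ toℕ b →
              (∀ k → toℕ a < toℕ k → toℕ k ≤ toℕ b → c C k ∉ S) →
              ReachAvoiding G S (c C a) (c C b)
  cycle-arc C a b a≤b = arc (toℕ b ∸ toℕ a) b (m+[n∸m]≡n a≤b)
    where
    arc : ∀ d b → toℕ a + d ≡ toℕ b →
          (∀ k → toℕ a < toℕ k → toℕ k ≤ toℕ b → c C k ∉ S) → ReachAvoiding G S (c C a) (c C b)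
    arc zero b a+0≡b _ =
      subst (ReachAvoiding G S (c C a) ∘ c C) (Finₚ.toℕ-injective (trans (sym (+-identityʳ _)) a+0≡b)) here
    arc (suc d) fzero a+1+d≡0 _ = contradiction (trans (sym (+-suc (toℕ a) d)) a+1+d≡0) 1+n≢0
    arc (suc d) (fsuc i) a+1+d≡1+i avoid =
      reach-∷ʳ (arc d (inject₁ i) (trans a+d≡i (sym (Finₚ.toℕ-inject₁ i))) avoid′)
               (step C i) (avoid (fsuc i) (s≤s (≤-trans (m≤m+n (toℕ a) d) (≤-reflexive a+d≡i))) ≤-refl)
      where
      a+d≡i : toℕ a + d ≡ toℕ i
      a+d≡i = suc-injective (trans (sym (+-suc (toℕ a) d)) a+1+d≡1+i)
      avoid′ : ∀ k → toℕ a < toℕ k → toℕ k ≤ toℕ (inject₁ i) → c C k ∉ S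
      avoid′ k a<k k≤i = avoid k a<k (m≤n⇒m≤1+n (≤-trans k≤i (≤-reflexive (Finₚ.toℕ-inject₁ i))))

  visitsInOrder⇒reach : ∀ {p} {v : Fin (2 + p) → Fin (n G)} → Σ (Cycle G) (λ C → VisitsInOrder C v) →
                        (∀ {x} → x ∈ S → ∃ λ j → v (fsuc (fsuc j)) ≡ x) →
                        ReachAvoiding G S (v fzero) (v (fsuc fzero))
  visitsInOrder⇒reach (C , f , mono , visits) S⊆rest =
    subst₂ (ReachAvoiding G S) (visits fzero) (visits (fsuc fzero))
      (cycle-arc C (f fzero) (f (fsuc fzero)) (<⇒≤ (mono fzero (fsuc fzero) (s≤s z≤n))) avoid)
    where
    -- a vertex of S is visited after v 1, so it cannot sit on the arc from v 0 to v 1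
    avoid : ∀ k → toℕ (f fzero) < toℕ k → toℕ k ≤ toℕ (f (fsuc fzero)) → c C k ∉ S
    avoid k _ k≤f1 ck∈S with S⊆rest ck∈S
    ... | j , vj≡ck = <⇒≱ (mono (fsuc fzero) (fsuc (fsuc j)) (s≤s (s≤s z≤n)))
                          (subst (λ z → toℕ z ≤ toℕ (f (fsuc fzero))) (sym fj≡k) k≤f1)
      where
      fj≡k : f (fsuc (fsuc j)) ≡ k
      fj≡k = distinct C (trans (visits (fsuc (fsuc j))) vj≡ck)

module _ {G : Graph} (s : ℕ) (ordered : POrdered (2 + s) G) (2+s≤n : 2 + s ≤ n G)
         {T : Subset (n G)} (∣T∣≤s : ∣ T ∣ ≤ s) where

  POrdered⇒reach : ∀ {u w} → u ∉ T → w ∉ T → u ≢ w → ReachAvoiding G T u w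
  POrdered⇒reach {u} {w} u∉T w∉T u≢w =
    visitsInOrder⇒reach (ordered (u ∷ᶠ w ∷ᶠ enum L) v-injective) (covers L)
    where
    Y = ⁅ u ⁆ ∪ ⁅ w ⁆
    u∈Y : u ∈ Y
    u∈Y = x∈p∪q⁺ (inj₁ (x∈⁅x⁆ u))
    w∈Y : w ∈ Y
    w∈Y = x∈p∪q⁺ (inj₂ (x∈⁅x⁆ w))
    T∩Y-empty : Empty (T ∩ Y)
    T∩Y-empty (x , x∈T∩Y) with x∈p∩q⁻ T Y x∈T∩Y
    ... | x∈T , x∈Y with x∈p∪q⁻ ⁅ u ⁆ ⁅ w ⁆ x∈Y
    ...   | inj₁ x∈⁅u⁆ = u∉T (subst (_∈ T) (x∈⁅y⁆⇒x≡y u x∈⁅u⁆) x∈T)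
    ...   | inj₂ x∈⁅w⁆ = w∉T (subst (_∈ T) (x∈⁅y⁆⇒x≡y w x∈⁅w⁆) x∈T)
    ∣Y∣≤2 : ∣ Y ∣ ≤ 2
    ∣Y∣≤2 = ≤-trans (∣p∪q∣≤∣p∣+∣q∣ ⁅ u ⁆ ⁅ w ⁆) (≤-reflexive (cong₂ _+_ (∣⁅x⁆∣≡1 u) (∣⁅x⁆∣≡1 w)))
    L : Listing s T Y
    L = listing s T Y T∩Y-empty ∣T∣≤s
          (≤-trans (+-monoʳ-≤ s ∣Y∣≤2) (≤-trans (≤-reflexive (+-comm s 2)) 2+s≤n))
    u∉rest : ∀ i → (w ∷ᶠ enum L) i ≢ u
    u∉rest fzero    = u≢w ∘ sym
    u∉rest (fsuc i) e = avoids L i (subst (_∈ Y) (sym e) u∈Y)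
    v-injective : Injective _≡_ _≡_ (u ∷ᶠ w ∷ᶠ enum L)
    v-injective = ∷-injective (∷-injective (injective L) (λ i e → avoids L i (subst (_∈ Y) (sym e) w∈Y)))
                              u∉rest

  POrdered⇒neighbour : ∀ {u} → u ∉ T → ∃ λ z → Adj G u z × z ∉ T
  POrdered⇒neighbour {u} u∉T =
    reach-firstEdge (POrdered⇒reach u∉T (w∉U ∘ x∈p∪q⁺ ∘ inj₁) u≢w) u≢w
    where
    U = T ∪ ⁅ u ⁆
    ∣U∣<n : ∣ U ∣ < n G
    ∣U∣<n = ≤-<-trans (∣p∪q∣≤∣p∣+∣q∣ T ⁅ u ⁆)
              (≤-<-trans (≤-trans (+-mono-≤ ∣T∣≤s (≤-reflexive (∣⁅x⁆∣≡1 u))) (≤-reflexive (+-comm s 1)))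
                         2+s≤n)
    w = proj₁ (∣p∣<n⇒∃∉ U ∣U∣<n)
    w∉U = proj₂ (∣p∣<n⇒∃∉ U ∣U∣<n)
    u≢w : u ≢ w
    u≢w u≡w = w∉U (x∈p∪q⁺ (inj₂ (subst (_∈ ⁅ u ⁆) u≡w (x∈⁅x⁆ u))))

  -- Ending at a neighbour of w lets the lift finish at any chosen copy of w, even when u = w.
  POrdered⇒reachNeighbourOf : ∀ {u w} → u ∉ T → w ∉ T → ∃ λ b → ReachAvoiding G T u b × Adj G b w
  POrdered⇒reachNeighbourOf {u} {w} u∉T w∉T with u ≟ w
  ... | yes refl = let z , u~z , z∉T = POrdered⇒neighbour u∉T in z , there u~z z∉T here , adj-sym G u~z
  ... | no  u≢w  = reach-lastEdge (POrdered⇒reach u∉T w∉T u≢w) u≢w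

lift-reach : ∀ q (G : Graph) (S : Subset (q * n G)) {a b} → ReachAvoiding G (allCopies q S) a b →
             ∀ {x y} → remainder {q} (n G) x ≡ a → y ∉ S → Adj G b (remainder {q} (n G) y) →
             ReachAvoiding (Complete q G) S x y
lift-reach q G S here refl y∉S b~y = there b~y y∉S here
lift-reach q G S (there {y = z} a~z z∉T r) refl y∉S b~y with ∉allCopies⇒∉ q S z∉T
... | i , copy∉S =
  there (subst (Adj G _) (sym (remainder-combine i z)) a~z) copy∉S
        (lift-reach q G S r (remainder-combine i z) y∉S b~y)

lemma19 : (q : ℕ) → 1 ≤ q → (G : Graph) → (p : ℕ) → 3 ≤ p → p ≤ n G →
    POrdered p G → KConnected (q * (p ∸ 1)) (Complete q G)
lemma19 (suc q) _ G (suc (suc (suc s))) (s≤s (s≤s (s≤s _))) p≤n ordered = *-monoʳ-< (suc q) p≤n , connected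
  where
  connected : ∀ S → ∣ S ∣ < suc q * (2 + s) → ConnectedWithout (Complete (suc q) G) S
  connected S ∣S∣< x y x∉S y∉S =
    let b , u⇝b , b~w = POrdered⇒reachNeighbourOf (suc s) ordered p≤n ∣T∣≤1+s
                          (∉⇒remainder∉allCopies (suc q) S x∉S) (∉⇒remainder∉allCopies (suc q) S y∉S)
    in lift-reach (suc q) G S u⇝b refl y∉S b~w
    where
    ∣T∣≤1+s : ∣ allCopies (suc q) S ∣ ≤ suc s
    ∣T∣≤1+s = ≤-pred (*-cancelˡ-< (suc q) _ _ (≤-<-trans (allCopies-card (suc q) S) ∣S∣<))
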